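{- Let $G$ be a tripartite oriented graph with parts $V_1,V_2,V_3$, each of size $n$, and let $\mathcal F$ be a bidirectionally balanced linear forest in $G$. Then $|V_1^+(\mathcal F)|=|V_2^+(\mathcal F)|=|V_3^+(\mathcal F)|=|V_1^-(\mathcal F)|=|V_2^-(\mathcal F)|=|V_3^-(\mathcal F)|$. If in addition $G\in\mathcal G_\beta(\overrightarrow{V_1},\overleftarrow{V_1};V_2,V_3)$, then $|\overrightarrow{V_1}^+(\mathcal F)|=|\overrightarrow{V_1}^-(\mathcal F)|$ and $|\overleftarrow{V_1}^+(\mathcal F)|=|\overleftarrow{V_1}^-(\mathcal F)|$.
   Context: An oriented graph has at most one directed edge between any pair of vertices. A linear forest is a digraph consisting of vertex-disjoint directed paths. For a set $S$ of vertices, $S^+(\mathcal F)$ is the set of $v\in S$ with $d^+_{\mathcal F}(v)=0$ and $S^-(\mathcal F)$ the set of $v\in S$ with $d^-_{\mathcal F}(v)=0$. $\mathcal F$ is bidirectionally balanced if $e_{\mathcal F}(V_1,V_2)=e_{\mathcal F}(V_2,V_3)=e_{\mathcal F}(V_3,V_1)$ and $e_{\mathcal F}(V_3,V_2)=e_{\mathcal F}(V_2,V_1)=e_{\mathcal F}(V_1,V_3)$, where $e_{\mathcal F}(X,Y)$ counts edges from $X$ to $Y$. For $\beta\in[0,1/2]$ with $\beta n\in\mathbb N$ and $V_1=\overrightarrow{V_1}\cup\overleftarrow{V_1}$ with $|\overleftarrow{V_1}|=\beta n$, $\mathcal G_\beta(\overrightarrow{V_1},\overleftarrow{V_1};V_2,V_3)$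 is the family of tripartite tournaments on parts $(V_1,V_2,V_3)$ with all edges from $V_3$ to $\overrightarrow{V_1}$, from $\overrightarrow{V_1}$ to $V_2$, from $V_2$ to $\overleftarrow{V_1}$, from $\overleftarrow{V_1}$ to $V_3$, plus a $\beta n$-regular bipartite graph between $V_3,V_2$ oriented from $V_3$ to $V_2$ and its complement oriented from $V_2$ to $V_3$. -}

module Defs where

open import Data.Nat using (ℕ; zero; suc; _+_; _*_; _≤_; _≡ᵇ_)
open import Data.Fin using (Fin; zero; suc)
open import Data.Bool using (Bool; true; false; T; not; _∧_)
open import Data.Product using (_×_; _,_)
open import Relation.Binary.PropositionalEquality using (_≡_; _≢_)
open import Relation.Nullary using (¬_)

sumFin : (n : ℕ) → (Fin n → ℕ) → ℕ
sumFin zero    f = 0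
sumFin (suc n) f = f zero + sumFin n (λ i → f (suc i))

𝟙 : Bool → ℕ
𝟙 true  = 1
𝟙 false = 0

countFin : (n : ℕ) → (Fin n → Bool) → ℕ
countFin n p = sumFin n (λ i → 𝟙 (p i))

Part : Set
Part = Fin 3

P₁ P₂ P₃ : Part
P₁ = zero
P₂ = suc zero
P₃ = suc (suc zero)

-- Vertex set V₁ ∪ V₂ ∪ V₃ with |Vᵢ| = n: vertex (i , x) is the x-th vertex of Vᵢ.
Vtx : ℕ → Set
Vtx n = Part × Fin n

-- A digraph on Vtx n, given by its (decidable) edge relation: G u v = true iff u → v.
Digraph : ℕ → Set
Digraph n = Vtx n → Vtx n → Bool

IsTripartiteOriented : {n : ℕ} → Digraph n → Set
IsTripartiteOriented {n} G =
  (∀ (i : Part) (x y : Fin n) → ¬ T (G (i , x) (i , y))) ×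
  (∀ (u v : Vtx n) → ¬ (T (G u v) × T (G v u)))

outdeg : {n : ℕ} → Digraph n → Vtx n → ℕ
outdeg {n} F v = sumFin 3 (λ j → countFin n (λ y → F v (j , y)))

indeg : {n : ℕ} → Digraph n → Vtx n → ℕ
indeg {n} F v = sumFin 3 (λ j → countFin n (λ y → F (j , y) v))

-- Directed walks of length ≥ 1 in F.
data Walk {n : ℕ} (F : Digraph n) : Vtx n → Vtx n → Set where
  edge : ∀ {u v} → T (F u v) → Walk F u v
  step : ∀ {u w v} → T (F u w) → Walk F w v → Walk F u v

_⊆G_ : {n : ℕ} → Digraph n → Digraph n → Set
_⊆G_ {n} F G = ∀ (u v : Vtx n) → T (F u v) → T (G u v)

-- Linear forest in G: a subdigraph of G which is a disjoint union of directed
-- paths (every vertex has in- and out-degree ≤ 1, and there is no directed cycle).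
IsLinearForestIn : {n : ℕ} → Digraph n → Digraph n → Set
IsLinearForestIn {n} F G =
  (F ⊆G G) ×
  (∀ (v : Vtx n) → outdeg F v ≤ 1) ×
  (∀ (v : Vtx n) → indeg F v ≤ 1) ×
  (∀ (v : Vtx n) → ¬ Walk F v v)

eF : {n : ℕ} → Digraph n → Part → Part → ℕ
eF {n} F i j = sumFin n (λ x → countFin n (λ y → F (i , x) (j , y)))

IsBidirectionallyBalanced : {n : ℕ} → Digraph n → Set
IsBidirectionallyBalanced F =
  (eF F P₁ P₂ ≡ eF F P₂ P₃) × (eF F P₂ P₃ ≡ eF F P₃ P₁) ×
  (eF F P₃ P₂ ≡ eF F P₂ P₁) × (eF F P₂ P₁ ≡ eF F P₁ P₃)

-- |S⁺(F)| and |S⁻(F)| for S ⊆ Vᵢ given by a Boolean predicate S on Fin n.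
card⁺ : {n : ℕ} → Digraph n → Part → (Fin n → Bool) → ℕ
card⁺ {n} F i S = countFin n (λ x → S x ∧ (outdeg F (i , x) ≡ᵇ 0))

card⁻ : {n : ℕ} → Digraph n → Part → (Fin n → Bool) → ℕ
card⁻ {n} F i S = countFin n (λ x → S x ∧ (indeg F (i , x) ≡ᵇ 0))

whole : {n : ℕ} → Fin n → Bool
whole _ = true

-- Membership in 𝒢_β(V₁→, V₁←; V₂, V₃), with b = βn and V₁← = {x : back x = true},
-- V₁→ = {x : back x = false}.
InGβ : {n : ℕ} → (b : ℕ) → (back : Fin n → Bool) → Digraph n → Set
InGβ {n} b back G =
  (countFin n back ≡ b) ×
  (∀ (x : Fin n) → T (not (back x)) → ∀ (z : Fin n) → T (G (P₃ , z) (P₁ , x))) ×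
  (∀ (x : Fin n) → T (not (back x)) → ∀ (y : Fin n) → T (G (P₁ , x) (P₂ , y))) ×
  (∀ (x : Fin n) → T (back x) → ∀ (y : Fin n) → T (G (P₂ , y) (P₁ , x))) ×
  (∀ (x : Fin n) → T (back x) → ∀ (z : Fin n) → T (G (P₁ , x) (P₃ , z))) ×
  (∀ (y z : Fin n) → T (G (P₃ , z) (P₂ , y)) ⊎′ T (G (P₂ , y) (P₃ , z))) ×
  (∀ (z : Fin n) → countFin n (λ y → G (P₃ , z) (P₂ , y)) ≡ b) ×
  (∀ (y : Fin n) → countFin n (λ z → G (P₃ , z) (P₂ , y)) ≡ b)
  where
  open import Data.Sum using () renaming (_⊎_ to _⊎′_)

-- In a linear forest every vertex has out-degree at most 1, so for a set S inside one part,
-- |S| = |S⁺(F)| + (number of F-edges leaving S); dually |S| = |S⁻(F)| + (number entering S).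
-- With no edges inside a part, bidirectional balance says the edge counts between the parts
-- are a along the cycle V₁ → V₂ → V₃ → V₁ and c against it, so every part sends and
-- receives a + c edges and all six sets V_i^± have n − (a + c) elements.  In 𝒢_β the
-- orientation of G forces the F-edges at V₁→ to run V₃ → V₁→ → V₂ and those at V₁← to run
-- V₂ → V₁← → V₃, so their exits and entries are counted by e(V₁,V₂) = e(V₃,V₁) and
-- e(V₁,V₃) = e(V₂,V₁) respectively.
module Submission where

open import Defs
open import Data.Bool using (Bool; true; false; not; T; _∧_)
open import Data.Bool.Properties using (not-involutive)
open import Data.Empty using (⊥-elim)
open import Data.Fin using (Fin; zero; suc)
open import Data.Fin.Patterns using (0F; 1F; 2F)
open import Data.Fin.Properties using (suc-injective)
open import Data.Nat using (ℕ; zero; suc; _+_; _*_; _≤_; _≡ᵇ_; z≤n; s≤s)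
open import Data.Nat.Properties
  using (+-0-commutativeMonoid; +-comm; +-identityʳ; *-identityˡ; +-cancelʳ-≡)
open import Algebra.Properties.CommutativeMonoid.Sum +-0-commutativeMonoid
  using (sum; sum-cong-≗; ∑-distrib-+; ∑-comm)
open import Data.Product using (_×_; _,_; proj₁; proj₂)
open import Data.Unit using (tt)
open import Function using (_∘_)
open import Relation.Binary.PropositionalEquality
  using (_≡_; _≢_; _≗_; refl; sym; trans; cong; cong₂; subst; module ≡-Reasoning)
open import Relation.Nullary using (¬_)

open ≡-Reasoning

sumFin≡sum : ∀ n (f : Fin n → ℕ) → sumFin n f ≡ sum f
sumFin≡sum zero    f = refl
sumFin≡sum (suc n) f = cong (f zero +_) (sumFin≡sum n (f ∘ suc))

sumFin-cong : ∀ n {f g : Fin n → ℕ} → f ≗ g → sumFin n f ≡ sumFin n g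
sumFin-cong zero    f≗g = refl
sumFin-cong (suc n) f≗g = cong₂ _+_ (f≗g zero) (sumFin-cong n (f≗g ∘ suc))

sumFin-zero : ∀ n {f : Fin n → ℕ} → (∀ i → f i ≡ 0) → sumFin n f ≡ 0
sumFin-zero zero    f≡0 = refl
sumFin-zero (suc n) f≡0 = cong₂ _+_ (f≡0 zero) (sumFin-zero n (f≡0 ∘ suc))

sumFin-distrib-+ : ∀ n (f g : Fin n → ℕ) →
  sumFin n (λ i → f i + g i) ≡ sumFin n f + sumFin n g
sumFin-distrib-+ n f g = begin
  sumFin n (λ i → f i + g i)  ≡⟨ sumFin≡sum n _ ⟩
  sum (λ i → f i + g i)       ≡⟨ ∑-distrib-+ f g ⟩
  sum f + sum g               ≡⟨ cong₂ _+_ (sumFin≡sum n f) (sumFin≡sum n g) ⟨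
  sumFin n f + sumFin n g     ∎

sumFin-comm : ∀ m n (f : Fin m → Fin n → ℕ) →
  sumFin m (λ i → sumFin n (f i)) ≡ sumFin n (λ j → sumFin m (λ i → f i j))
sumFin-comm m n f = begin
  sumFin m (λ i → sumFin n (f i))             ≡⟨ sumFin≡sum m _ ⟩
  sum (λ i → sumFin n (f i))                  ≡⟨ sum-cong-≗ (λ i → sumFin≡sum n (f i)) ⟩
  sum (λ i → sum (f i))                       ≡⟨ ∑-comm f ⟩
  sum (λ j → sum (λ i → f i j))               ≡⟨ sum-cong-≗ (λ j → sumFin≡sum m (λ i → f i j)) ⟨
  sum (λ j → sumFin m (λ i → f i j))          ≡⟨ sumFin≡sum n _ ⟨
  sumFin n (λ j → sumFin m (λ i → f i j))     ∎

sumFin-concentrated : ∀ n (f : Fin n → ℕ) j → (∀ k → k ≢ j → f k ≡ 0) → sumFin n f ≡ f j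
sumFin-concentrated (suc n) f zero    f≡0 =
  trans (cong (f zero +_) (sumFin-zero n (λ k → f≡0 (suc k) λ ()))) (+-identityʳ (f zero))
sumFin-concentrated (suc n) f (suc j) f≡0 =
  cong₂ _+_ (f≡0 zero λ ())
            (sumFin-concentrated n (f ∘ suc) j (λ k k≢j → f≡0 (suc k) (k≢j ∘ suc-injective)))

countFin-none : ∀ n {p : Fin n → Bool} → (∀ i → ¬ T (p i)) → countFin n p ≡ 0
countFin-none n ¬p = sumFin-zero n (λ i → 𝟙-false (¬p i))
  where
  𝟙-false : ∀ {b} → ¬ T b → 𝟙 b ≡ 0
  𝟙-false {false} _  = refl
  𝟙-false {true}  ¬b = ⊥-elim (¬b tt)

countFin-whole : ∀ n → countFin n whole ≡ n
countFin-whole zero    = refl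
countFin-whole (suc n) = cong suc (countFin-whole n)

-- Each x ∈ S contributes 1 to exactly one of the two sums, since d x ∈ {0, 1}.
countFin-zeros+weighted : ∀ n (S : Fin n → Bool) (d : Fin n → ℕ) → (∀ x → d x ≤ 1) →
  countFin n (λ x → S x ∧ (d x ≡ᵇ 0)) + sumFin n (λ x → 𝟙 (S x) * d x) ≡ countFin n S
countFin-zeros+weighted n S d d≤1 = begin
  countFin n (λ x → S x ∧ (d x ≡ᵇ 0)) + sumFin n (λ x → 𝟙 (S x) * d x)
    ≡⟨ sumFin-distrib-+ n _ _ ⟨
  sumFin n (λ x → 𝟙 (S x ∧ (d x ≡ᵇ 0)) + 𝟙 (S x) * d x)
    ≡⟨ sumFin-cong n (λ x → split (S x) (d≤1 x)) ⟩
  countFin n S ∎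
  where
  split : ∀ s {k} → k ≤ 1 → 𝟙 (s ∧ (k ≡ᵇ 0)) + 𝟙 s * k ≡ 𝟙 s
  split false _           = refl
  split true  z≤n         = refl
  split true  (s≤s z≤n)   = refl

reverse : ∀ {n} → Digraph n → Digraph n
reverse F u v = F v u

ExitsOnlyInto : ∀ {n} → Digraph n → Vtx n → Part → Set
ExitsOnlyInto {n} F v j = ∀ (k : Part) (y : Fin n) → T (F v (k , y)) → k ≡ j

NoExitInto : ∀ {n} → Digraph n → Vtx n → Part → Set
NoExitInto {n} F v j = ∀ (y : Fin n) → ¬ T (F v (j , y))

module _ {n : ℕ} (F : Digraph n) where

  eF-reverse : ∀ i j → eF (reverse F) i j ≡ eF F j i
  eF-reverse i j = sumFin-comm n n (λ x y → 𝟙 (F (j , y) (i , x)))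

  outdeg-concentrated : ∀ v j → ExitsOnlyInto F v j →
    outdeg F v ≡ countFin n (λ y → F v (j , y))
  outdeg-concentrated v j only = sumFin-concentrated 3 _ j
    (λ k k≢j → countFin-none n (λ y e → k≢j (only k y e)))

  module _ (outdeg≤1 : ∀ v → outdeg F v ≤ 1) where

    card⁺-whole : ∀ i → card⁺ F i whole + sumFin 3 (eF F i) ≡ n
    card⁺-whole i = begin
      card⁺ F i whole + sumFin 3 (eF F i)
        ≡⟨ cong (card⁺ F i whole +_) (sumFin-comm n 3 (λ x j → countFin n (λ y → F (i , x) (j , y)))) ⟨
      card⁺ F i whole + sumFin n (λ x → outdeg F (i , x))
        ≡⟨ cong (card⁺ F i whole +_) (sumFin-cong n (λ x → *-identityˡ (outdeg F (i , x)))) ⟨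
      card⁺ F i whole + sumFin n (λ x → 1 * outdeg F (i , x))
        ≡⟨ countFin-zeros+weighted n whole (λ x → outdeg F (i , x)) (outdeg≤1 ∘ (i ,_)) ⟩
      countFin n whole
        ≡⟨ countFin-whole n ⟩
      n ∎

    card⁺-exitsInto : ∀ i j S →
      (∀ x → T (S x) → ExitsOnlyInto F (i , x) j) →
      (∀ x → T (not (S x)) → NoExitInto F (i , x) j) →
      card⁺ F i S + eF F i j ≡ countFin n S
    card⁺-exitsInto i j S only none = begin
      card⁺ F i S + eF F i j
        ≡⟨ cong (card⁺ F i S +_) (sumFin-cong n exits) ⟨
      card⁺ F i S + sumFin n (λ x → 𝟙 (S x) * outdeg F (i , x))
        ≡⟨ countFin-zeros+weighted n S (λ x → outdeg F (i , x)) (outdeg≤1 ∘ (i ,_)) ⟩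
      countFin n S ∎
      where
      exits : ∀ x → 𝟙 (S x) * outdeg F (i , x) ≡ countFin n (λ y → F (i , x) (j , y))
      exits x with S x | only x | none x
      ... | true  | only-x | _      =
        trans (*-identityˡ _) (outdeg-concentrated (i , x) j (only-x tt))
      ... | false | _      | none-x = sym (countFin-none n (none-x tt))

-- card⁻ F, indeg F and the in-degree conditions are definitionally card⁺, outdeg and the
-- out-degree conditions of reverse F.
module _ {n : ℕ} (F : Digraph n) (indeg≤1 : ∀ v → indeg F v ≤ 1) where

  card⁻-whole : ∀ i → card⁻ F i whole + sumFin 3 (λ j → eF F j i) ≡ n
  card⁻-whole i = trans (cong (card⁻ F i whole +_) (sumFin-cong 3 (sym ∘ eF-reverse F i)))
                        (card⁺-whole (reverse F) indeg≤1 i)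

  card⁻-entersFrom : ∀ i k S →
    (∀ x → T (S x) → ExitsOnlyInto (reverse F) (i , x) k) →
    (∀ x → T (not (S x)) → NoExitInto (reverse F) (i , x) k) →
    card⁻ F i S + eF F k i ≡ countFin n S
  card⁻-entersFrom i k S only none =
    trans (cong (card⁻ F i S +_) (sym (eF-reverse F i k)))
          (card⁺-exitsInto (reverse F) indeg≤1 i k S only none)

cyclicCounts : ℕ → ℕ → Part → Part → ℕ
cyclicCounts a c 0F 0F = 0
cyclicCounts a c 0F 1F = a
cyclicCounts a c 0F 2F = c
cyclicCounts a c 1F 0F = c
cyclicCounts a c 1F 1F = 0
cyclicCounts a c 1F 2F = a
cyclicCounts a c 2F 0F = a
cyclicCounts a c 2F 1F = c
cyclicCounts a c 2F 2F = 0

cyclicCounts-row : ∀ a c i → sumFin 3 (cyclicCounts a c i) ≡ a + c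
cyclicCounts-row a c 0F = cong (a +_) (+-identityʳ c)
cyclicCounts-row a c 1F = trans (cong (c +_) (+-identityʳ a)) (+-comm c a)
cyclicCounts-row a c 2F = cong (a +_) (+-identityʳ c)

cyclicCounts-column : ∀ a c j → sumFin 3 (λ i → cyclicCounts a c i j) ≡ a + c
cyclicCounts-column a c 0F = trans (cong (c +_) (+-identityʳ a)) (+-comm c a)
cyclicCounts-column a c 1F = cong (a +_) (+-identityʳ c)
cyclicCounts-column a c 2F = trans (cong (c +_) (+-identityʳ a)) (+-comm c a)

module _ {n : ℕ} {G F : Digraph n} (tripartite : IsTripartiteOriented G) (F⊆G : F ⊆G G) where

  ¬F-withinPart : ∀ i x y → ¬ T (F (i , x) (i , y))
  ¬F-withinPart i x y e = proj₁ tripartite i x y (F⊆G _ _ e)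

  ¬F-againstG : ∀ {u v} → T (G v u) → ¬ T (F u v)
  ¬F-againstG g e = proj₂ tripartite _ _ (F⊆G _ _ e , g)

  eF-withinPart : ∀ i → eF F i i ≡ 0
  eF-withinPart i = sumFin-zero n (λ x → countFin-none n (¬F-withinPart i x))

  eF-cyclic : IsBidirectionallyBalanced F →
    ∀ i j → eF F i j ≡ cyclicCounts (eF F P₁ P₂) (eF F P₁ P₃) i j
  eF-cyclic _                    0F 0F = eF-withinPart P₁
  eF-cyclic _                    0F 1F = refl
  eF-cyclic _                    0F 2F = refl
  eF-cyclic (_  , _  , _  , b₄) 1F 0F = b₄
  eF-cyclic _                    1F 1F = eF-withinPart P₂
  eF-cyclic (b₁ , _  , _  , _ ) 1F 2F = sym b₁
  eF-cyclic (b₁ , b₂ , _  , _ ) 2F 0F = sym (trans b₁ b₂)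
  eF-cyclic (_  , _  , b₃ , b₄) 2F 1F = trans b₃ b₄
  eF-cyclic _                    2F 2F = eF-withinPart P₃

  module _ (forest : IsLinearForestIn F G) (balanced : IsBidirectionallyBalanced F) where

    private
      outdeg≤1 = proj₁ (proj₂ forest)
      indeg≤1  = proj₁ (proj₂ (proj₂ forest))
      a = eF F P₁ P₂
      c = eF F P₁ P₃

    card⁺-balanced : ∀ i → card⁺ F i whole + (a + c) ≡ n
    card⁺-balanced i = begin
      card⁺ F i whole + (a + c)
        ≡⟨ cong (card⁺ F i whole +_) (cyclicCounts-row a c i) ⟨
      card⁺ F i whole + sumFin 3 (cyclicCounts a c i)
        ≡⟨ cong (card⁺ F i whole +_) (sumFin-cong 3 (eF-cyclic balanced i)) ⟨
      card⁺ F i whole + sumFin 3 (eF F i)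
        ≡⟨ card⁺-whole F outdeg≤1 i ⟩
      n ∎

    card⁻-balanced : ∀ i → card⁻ F i whole + (a + c) ≡ n
    card⁻-balanced i = begin
      card⁻ F i whole + (a + c)
        ≡⟨ cong (card⁻ F i whole +_) (cyclicCounts-column a c i) ⟨
      card⁻ F i whole + sumFin 3 (λ j → cyclicCounts a c j i)
        ≡⟨ cong (card⁻ F i whole +_) (sumFin-cong 3 (λ j → eF-cyclic balanced j i)) ⟨
      card⁻ F i whole + sumFin 3 (λ j → eF F j i)
        ≡⟨ card⁻-whole F indeg≤1 i ⟩
      n ∎

    card⁺≡card⁻-ofPassage : ∀ i j k S →
      (∀ x → T (S x) → ExitsOnlyInto F (i , x) j) →
      (∀ x → T (not (S x)) → NoExitInto F (i , x) j) →
      (∀ x → T (S x) → ExitsOnlyInto (reverse F) (i , x) k) →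
      (∀ x → T (not (S x)) → NoExitInto (reverse F) (i , x) k) →
      eF F i j ≡ eF F k i → card⁺ F i S ≡ card⁻ F i S
    card⁺≡card⁻-ofPassage i j k S exits noExit enters noEntry flow = +-cancelʳ-≡ _ _ _ (begin
      card⁺ F i S + eF F i j  ≡⟨ card⁺-exitsInto F outdeg≤1 i j S exits noExit ⟩
      countFin n S            ≡⟨ card⁻-entersFrom F indeg≤1 i k S enters noEntry ⟨
      card⁻ F i S + eF F k i  ≡⟨ cong (card⁻ F i S +_) flow ⟨
      card⁻ F i S + eF F i j  ∎)

    module _ {b : ℕ} {back : Fin n → Bool} (Gβ : InGβ b back G) where

      private
        P₃⇒fwd = proj₁ (proj₂ Gβ)
        fwd⇒P₂ = proj₁ (proj₂ (proj₂ Gβ))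
        P₂⇒bwd = proj₁ (proj₂ (proj₂ (proj₂ Gβ)))
        bwd⇒P₃ = proj₁ (proj₂ (proj₂ (proj₂ (proj₂ Gβ))))
        notNot : ∀ x → T (not (not (back x))) → T (back x)
        notNot x = subst T (not-involutive (back x))

      card⁺≡card⁻-forward : card⁺ F P₁ (not ∘ back) ≡ card⁻ F P₁ (not ∘ back)
      card⁺≡card⁻-forward = card⁺≡card⁻-ofPassage P₁ P₂ P₃ (not ∘ back)
        exits (λ x x∉ y → ¬F-againstG (P₂⇒bwd x (notNot x x∉) y))
        enters (λ x x∉ z → ¬F-againstG (bwd⇒P₃ x (notNot x x∉) z))
        (trans (proj₁ balanced) (proj₁ (proj₂ balanced)))
        where
        exits : ∀ x → T (not (back x)) → ExitsOnlyInto F (P₁ , x) P₂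
        exits x x∈ 0F y e = ⊥-elim (¬F-withinPart P₁ x y e)
        exits x x∈ 1F y e = refl
        exits x x∈ 2F y e = ⊥-elim (¬F-againstG (P₃⇒fwd x x∈ y) e)
        enters : ∀ x → T (not (back x)) → ExitsOnlyInto (reverse F) (P₁ , x) P₃
        enters x x∈ 0F y e = ⊥-elim (¬F-withinPart P₁ y x e)
        enters x x∈ 1F y e = ⊥-elim (¬F-againstG (fwd⇒P₂ x x∈ y) e)
        enters x x∈ 2F y e = refl

      card⁺≡card⁻-backward : card⁺ F P₁ back ≡ card⁻ F P₁ back
      card⁺≡card⁻-backward = card⁺≡card⁻-ofPassage P₁ P₃ P₂ back
        exits (λ x x∉ z → ¬F-againstG (P₃⇒fwd x x∉ z))
        enters (λ x x∉ y → ¬F-againstG (fwd⇒P₂ x x∉ y))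
        (sym (proj₂ (proj₂ (proj₂ balanced))))
        where
        exits : ∀ x → T (back x) → ExitsOnlyInto F (P₁ , x) P₃
        exits x x∈ 0F y e = ⊥-elim (¬F-withinPart P₁ x y e)
        exits x x∈ 1F y e = ⊥-elim (¬F-againstG (P₂⇒bwd x x∈ y) e)
        exits x x∈ 2F y e = refl
        enters : ∀ x → T (back x) → ExitsOnlyInto (reverse F) (P₁ , x) P₂
        enters x x∈ 0F y e = ⊥-elim (¬F-withinPart P₁ y x e)
        enters x x∈ 1F y e = refl
        enters x x∈ 2F y e = ⊥-elim (¬F-againstG (bwd⇒P₃ x x∈ y) e)

fact4p21 : (n : ℕ) (G F : Digraph n) →
    IsTripartiteOriented G → IsLinearForestIn F G → IsBidirectionallyBalanced F →
    ((card⁺ F P₁ whole ≡ card⁺ F P₂ whole) × (card⁺ F P₂ whole ≡ card⁺ F P₃ whole) ×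
     (card⁺ F P₃ whole ≡ card⁻ F P₁ whole) × (card⁻ F P₁ whole ≡ card⁻ F P₂ whole) ×
     (card⁻ F P₂ whole ≡ card⁻ F P₃ whole)) ×
    ((b : ℕ) → 2 * b ≤ n → (back : Fin n → Bool) → InGβ b back G →
      (card⁺ F P₁ (λ x → not (back x)) ≡ card⁻ F P₁ (λ x → not (back x))) ×
      (card⁺ F P₁ back ≡ card⁻ F P₁ back))
fact4p21 n G F tripartite forest balanced =
  ( sameSize (sinks P₁) (sinks P₂) , sameSize (sinks P₂) (sinks P₃)
  , sameSize (sinks P₃) (sources P₁) , sameSize (sources P₁) (sources P₂)
  , sameSize (sources P₂) (sources P₃) )
  , λ _ _ _ Gβ → card⁺≡card⁻-forward tripartite F⊆G forest balanced Gβ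
                , card⁺≡card⁻-backward tripartite F⊆G forest balanced Gβ
  where
  F⊆G = proj₁ forest
  sinks   = card⁺-balanced tripartite F⊆G forest balanced
  sources = card⁻-balanced tripartite F⊆G forest balanced
  sameSize : ∀ {x y t} → x + t ≡ n → y + t ≡ n → x ≡ y
  sameSize {x} {y} {t} x+t≡n y+t≡n = +-cancelʳ-≡ t x y (trans x+t≡n (sym y+t≡n))
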